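{- Let $G_0$ be a claw-free graph, let $M$ be a matching of $G_0$ such that $G_0-e$ is claw-free for every $e\in M$, and let $G$ be a thickening of $G_0$ under $M$ which is strict, i.e. $|V(G_0)|<|V(G)|$. Then either $G$ contains a pair of twins $a,b\in I(v)$ for some $v\in V(G_0)$, or there exists an edge $vw\in M$ such that $(I(v),I(w))$ is a homogeneous pair of cliques of $G$.
   Context: A thickening of $G_0$ under $M$ is a graph obtained from $G_0$ by: (1) replacing each vertex $v$ of $G_0$ by a nonempty clique $I(v)$ (these cliques pairwise disjoint); (2) for every edge $uv\in E(G_0)$, adding all edges between $I(u)$ and $I(v)$; (3) for every $uv\in M$, removing a nonempty proper subset of the edges between $I(u)$ and $I(v)$. Two distinct vertices $a,b$ are twins if $N[a]=N[b]$ (closed neighborhoods). A homogeneous pair of cliques in $G$ is a pair $(A,B)$ of cliques such that every vertex outside $A\cup B$ is complete or anticomplete to $A$ and complete or anticomplete to $B$, and $|A|+|B|\ge 3$. -}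

module Defs where

open import Data.Nat using (ℕ; _<_; _≤_; _+_)
open import Data.Fin using (Fin; _≟_)
open import Data.Fin.Subset using (Subset; _∈_; _∉_; ∣_∣)
open import Data.Vec using (tabulate)
open import Data.Product using (Σ; ∃; ∃-syntax; _×_; _,_)
open import Data.Sum using (_⊎_)
open import Relation.Nullary using (¬_; Dec; does)
open import Relation.Binary.PropositionalEquality using (_≡_; _≢_)
open import Function.Bundles using (_⇔_)

record Graph (n : ℕ) : Set₁ where
  field
    _~_    : Fin n → Fin n → Set
    ~-sym  : ∀ {x y} → x ~ y → y ~ x
    ~-irr  : ∀ {x} → ¬ (x ~ x)
    ~-dec  : ∀ x y → Dec (x ~ y)
open Graph public

ClawFreeRel : {n : ℕ} → (Fin n → Fin n → Set) → Set
ClawFreeRel {n} E =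
  ¬ (Σ (Fin n) λ c → Σ (Fin n) λ a → Σ (Fin n) λ b → Σ (Fin n) λ d →
       E c a × E c b × E c d ×
       a ≢ b × a ≢ d × b ≢ d ×
       ¬ E a b × ¬ E a d × ¬ E b d)

ClawFree : {n : ℕ} → Graph n → Set
ClawFree G = ClawFreeRel (_~_ G)

removeEdge : {n : ℕ} → Graph n → Fin n → Fin n → Fin n → Fin n → Set
removeEdge G u v x y =
  (_~_ G x y) × ¬ ((x ≡ u × y ≡ v) ⊎ (x ≡ v × y ≡ u))

record IsMatching {n : ℕ} (G : Graph n) (M : Fin n → Fin n → Set) : Set where
  field
    M-sym  : ∀ {u v} → M u v → M v u
    M-edge : ∀ {u v} → M u v → _~_ G u v
    M-uniq : ∀ {u v w} → M u v → M u w → v ≡ w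
    M-dec  : ∀ u v → Dec (M u v)

-- G (on Fin m) is a thickening of G0 (on Fin n) under M, with
-- I : Fin m → Fin n sending each vertex of G to the vertex v with x ∈ I(v).
record IsThickening {n m : ℕ} (G0 : Graph n) (M : Fin n → Fin n → Set)
                    (G : Graph m) (I : Fin m → Fin n) : Set where
  field
    nonempty    : ∀ v → ∃[ x ] I x ≡ v
    clique      : ∀ x y → x ≢ y → I x ≡ I y → _~_ G x y
    complete    : ∀ x y → I x ≢ I y → _~_ G0 (I x) (I y) → ¬ M (I x) (I y) → _~_ G x y
    anticomplete : ∀ x y → I x ≢ I y → ¬ _~_ G0 (I x) (I y) → ¬ _~_ G x y
    someKept    : ∀ u v → M u v → ∃[ x ] ∃[ y ] (I x ≡ u × I y ≡ v × _~_ G x y)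
    someRemoved : ∀ u v → M u v → ∃[ x ] ∃[ y ] (I x ≡ u × I y ≡ v × ¬ _~_ G x y)

bag : {n m : ℕ} → (Fin m → Fin n) → Fin n → Subset m
bag I v = tabulate (λ x → does (I x ≟ v))

InClosedNbhd : {m : ℕ} → Graph m → Fin m → Fin m → Set
InClosedNbhd G a z = z ≡ a ⊎ _~_ G a z

Twins : {m : ℕ} → Graph m → Fin m → Fin m → Set
Twins {m} G a b = a ≢ b × (∀ (z : Fin m) → InClosedNbhd G a z ⇔ InClosedNbhd G b z)

IsClique : {m : ℕ} → Graph m → Subset m → Set
IsClique G A = ∀ x y → x ∈ A → y ∈ A → x ≢ y → _~_ G x y

CompleteTo : {m : ℕ} → Graph m → Fin m → Subset m → Set
CompleteTo G z A = ∀ x → x ∈ A → _~_ G z x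

AnticompleteTo : {m : ℕ} → Graph m → Fin m → Subset m → Set
AnticompleteTo G z A = ∀ x → x ∈ A → ¬ _~_ G z x

HomogeneousPairOfCliques : {m : ℕ} → Graph m → Subset m → Subset m → Set
HomogeneousPairOfCliques {m} G A B =
  IsClique G A × IsClique G B ×
  (∀ (z : Fin m) → z ∉ A → z ∉ B →
     (CompleteTo G z A ⊎ AnticompleteTo G z A) ×
     (CompleteTo G z B ⊎ AnticompleteTo G z B)) ×
  3 ≤ ∣ A ∣ + ∣ B ∣

{-# OPTIONS --safe #-}
-- Since m > n, two distinct vertices a, b of G lie in one bag I(v). A vertex z outside I(v)
-- can distinguish members of I(v) only if I(z) is the M-partner of v, since every other bag is
-- complete or anticomplete to I(v). So if v is unmatched, a and b are twins; if vw ∈ M, then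
-- (I(v), I(w)) is a homogeneous pair of cliques, of total size at least 2 + 1.
module Submission where

open import Defs
open import Data.Nat using (ℕ; _<_; s≤s; z≤n)
open import Data.Nat.Properties using (≤-trans; +-mono-≤)
open import Data.Fin using (Fin; _≟_)
open import Data.Fin.Properties using (pigeonhole; any?; <⇒≢)
open import Data.Fin.Subset using (Subset; _∈_; _∉_; ∣_∣)
open import Data.Fin.Subset.Properties using (x∈p⇒∣p-x∣<∣p∣; x∈p∧x≢y⇒x∈p-y)
open import Data.Vec using (tabulate)
open import Data.Vec.Properties using (lookup∘tabulate; lookup⇒[]=; []=⇒lookup)
open import Data.Product using (∃; ∃-syntax; _×_; _,_)
open import Data.Sum using (_⊎_; inj₁; inj₂)
open import Function using (_∘_; case_of_)
open import Function.Bundles using (_⇔_; mk⇔)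
open import Relation.Nullary using (¬_; yes; no; does; contradiction)
open import Relation.Nullary.Decidable using (dec-true)
open import Relation.Unary using (Pred; Decidable)
open import Relation.Binary.PropositionalEquality using (_≡_; _≢_; refl; sym; trans)

module _ {k : ℕ} where

  x∈p⇒0<∣p∣ : ∀ {p : Subset k} {x} → x ∈ p → 0 < ∣ p ∣
  x∈p⇒0<∣p∣ x∈p = ≤-trans (s≤s z≤n) (x∈p⇒∣p-x∣<∣p∣ x∈p)

  x∈p∧y∈p∧x≢y⇒1<∣p∣ : ∀ {p : Subset k} {x y} → x ∈ p → y ∈ p → x ≢ y → 1 < ∣ p ∣
  x∈p∧y∈p∧x≢y⇒1<∣p∣ x∈p y∈p x≢y =
    ≤-trans (s≤s (x∈p⇒0<∣p∣ (x∈p∧x≢y⇒x∈p-y y∈p (x≢y ∘ sym)))) (x∈p⇒∣p-x∣<∣p∣ x∈p)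

module _ {k : ℕ} {ℓ} {P : Pred (Fin k) ℓ} (P? : Decidable P) where

  ∈-tabulate⁺ : ∀ {x} → P x → x ∈ tabulate (does ∘ P?)
  ∈-tabulate⁺ {x} px = lookup⇒[]= x _ (trans (lookup∘tabulate _ x) (dec-true (P? x) px))

  ∈-tabulate⁻ : ∀ {x} → x ∈ tabulate (does ∘ P?) → P x
  ∈-tabulate⁻ {x} x∈ with P? x | trans (sym (lookup∘tabulate (does ∘ P?) x)) ([]=⇒lookup x∈)
  ... | yes px | _ = px
  ... | no _   | ()

module _ {n m : ℕ} (I : Fin m → Fin n) where

  ∈-bag⁺ : ∀ {x v} → I x ≡ v → x ∈ bag I v
  ∈-bag⁺ {v = v} = ∈-tabulate⁺ (λ y → I y ≟ v)

  ∈-bag⁻ : ∀ {x v} → x ∈ bag I v → I x ≡ v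
  ∈-bag⁻ {v = v} = ∈-tabulate⁻ (λ y → I y ≟ v)

module Thickening {n m : ℕ} {G0 : Graph n} {M : Fin n → Fin n → Set}
                  {G : Graph m} {I : Fin m → Fin n} (T : IsThickening G0 M G I) where

  open IsThickening T

  bag-isClique : ∀ v → IsClique G (bag I v)
  bag-isClique v x y x∈v y∈v x≢y = clique x y x≢y (trans (∈-bag⁻ I x∈v) (sym (∈-bag⁻ I y∈v)))

  bag-nonempty : ∀ v → 0 < ∣ bag I v ∣
  bag-nonempty v with x , Ix≡v ← nonempty v = x∈p⇒0<∣p∣ (∈-bag⁺ I Ix≡v)

  complete⊎anticomplete : ∀ z v → I z ≢ v → ¬ M (I z) v →
                          CompleteTo G z (bag I v) ⊎ AnticompleteTo G z (bag I v)
  complete⊎anticomplete z v Iz≢v ¬Mzv with ~-dec G0 (I z) v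
  ... | yes Iz~v = inj₁ λ x x∈v → case ∈-bag⁻ I x∈v of λ { refl → complete z x Iz≢v Iz~v ¬Mzv }
  ... | no ¬Iz~v = inj₂ λ x x∈v → case ∈-bag⁻ I x∈v of λ { refl → anticomplete z x Iz≢v ¬Iz~v }

  module _ (isM : IsMatching G0 M) where

    open IsMatching isM

    unmatchedBag-N[a]⊆N[b] : ∀ {v a b} → ¬ ∃ (M v) → I a ≡ v → I b ≡ v → a ≢ b →
                             ∀ z → InClosedNbhd G a z → InClosedNbhd G b z
    unmatchedBag-N[a]⊆N[b] {a = a} {b} _ Ia≡v refl a≢b z (inj₁ refl) =
      inj₂ (clique b a (a≢b ∘ sym) (sym Ia≡v))
    unmatchedBag-N[a]⊆N[b] {b = b} unmatched Ia≡v refl a≢b z (inj₂ a~z) with z ≟ b | I z ≟ I b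
    ... | yes z≡b | _ = inj₁ z≡b
    ... | no z≢b | yes Iz≡Ib = inj₂ (clique b z (z≢b ∘ sym) (sym Iz≡Ib))
    ... | no _   | no Iz≢Ib
      with complete⊎anticomplete z (I b) Iz≢Ib (λ Mzb → unmatched (I z , M-sym Mzb))
    ...   | inj₁ z⇒bag = inj₂ (~-sym G (z⇒bag b (∈-bag⁺ I refl)))
    ...   | inj₂ z⇏bag = contradiction (~-sym G a~z) (z⇏bag _ (∈-bag⁺ I Ia≡v))

    unmatchedBag-twins : ∀ {v a b} → ¬ ∃ (M v) → I a ≡ v → I b ≡ v → a ≢ b → Twins G a b
    unmatchedBag-twins unmatched Ia≡v Ib≡v a≢b = a≢b , λ z →
      mk⇔ (unmatchedBag-N[a]⊆N[b] unmatched Ia≡v Ib≡v a≢b z)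
          (unmatchedBag-N[a]⊆N[b] unmatched Ib≡v Ia≡v (a≢b ∘ sym) z)

    matchedBags-homogeneous : ∀ {v w} → M v w → 1 < ∣ bag I v ∣ →
                              HomogeneousPairOfCliques G (bag I v) (bag I w)
    matchedBags-homogeneous {v} {w} Mvw 1<∣v∣ =
      bag-isClique v , bag-isClique w , outside , +-mono-≤ 1<∣v∣ (bag-nonempty w)
      where
      outside : ∀ z → z ∉ bag I v → z ∉ bag I w →
                (CompleteTo G z (bag I v) ⊎ AnticompleteTo G z (bag I v)) ×
                (CompleteTo G z (bag I w) ⊎ AnticompleteTo G z (bag I w))
      outside z z∉v z∉w =
        complete⊎anticomplete z v (z∉v ∘ ∈-bag⁺ I)
          (λ Mzv → z∉w (∈-bag⁺ I (M-uniq (M-sym Mzv) Mvw))) ,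
        complete⊎anticomplete z w (z∉w ∘ ∈-bag⁺ I)
          (λ Mzw → z∉v (∈-bag⁺ I (M-uniq (M-sym Mzw) (M-sym Mvw))))

open Thickening

lemma3p7 : {n m : ℕ} (G0 : Graph n) (M : Fin n → Fin n → Set)
           (G : Graph m) (I : Fin m → Fin n) →
           ClawFree G0 →
           IsMatching G0 M →
           (∀ u v → M u v → ClawFreeRel (removeEdge G0 u v)) →
           IsThickening G0 M G I →
           n < m →
           (∃[ a ] ∃[ b ] (I a ≡ I b × Twins G a b)) ⊎
           (∃[ v ] ∃[ w ] (M v w × HomogeneousPairOfCliques G (bag I v) (bag I w)))
lemma3p7 G0 M G I _ isM _ T n<m with a , b , a<b , Ia≡Ib ← pigeonhole n<m I
                                 with any? (IsMatching.M-dec isM (I a))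
... | no unmatched =
  inj₁ (a , b , Ia≡Ib , unmatchedBag-twins T isM unmatched refl (sym Ia≡Ib) (<⇒≢ a<b))
... | yes (w , Maw) =
  inj₂ (I a , w , Maw , matchedBags-homogeneous T isM Maw
                          (x∈p∧y∈p∧x≢y⇒1<∣p∣ (∈-bag⁺ I refl) (∈-bag⁺ I (sym Ia≡Ib)) (<⇒≢ a<b)))
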